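{- Let $l:\mathbb{N}\to\mathbb{N}$ be given by $l(0)=0$ and $l(i+1)=2l(i)+1$. For every $m\in\mathbb{N}$, every graph $G$ and all tuples $\bar a,\bar b$ of vertices of $G$ of equal length: if $\bar a\not\cong_m\bar b$, then $\bar a\not\cong^D_{l(m)}\bar b$.
   Context: Graphs are finite, simple, undirected, loopless, possibly labelled by unary predicates. For $u,v\in V(G)$, $D(u,v)=N(u)\,\Delta\,N(v)$. For $\bar a=(a_1,\dots,a_k)$, $\bar b=(b_1,\dots,b_k)$: $\bar a\cong_m\bar b$ means Duplicator wins the standard $m$-round Ehrenfeucht–Fraïssé game on two copies of $G$ from position $(\bar a,\bar b)$. $\bar a\cong^D_m\bar b$ means Duplicator wins the $m$-round differential game on $G$ from $(\bar a,\bar b)$: in each round, with current tuples $(a_1,\dots,a_n)$, $(b_1,\dots,b_n)$, Spoiler chooses an index $i\le n$ and a vertex $w\in D(a_i,b_i)$ and declares whether $w$ becomes $a_{n+1}$ or $b_{n+1}$ (if all $D(a_i,b_i)$ are empty, Duplicator wins); Duplicator must reply with a vertex of $D(a_i,b_i)$ (same $i$), which becomes $b_{n+1}$, respectively $a_{n+1}$. In both games, at the end Duplicator wins iff for all $i,j$: $a_i=a_j\iff b_i=b_j$, $a_ia_j\in E\iff b_ib_j\in E$, and $a_i,b_i$ have the same labels.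
   Formalization: In the differential game, when all $D(a_i,b_i)$ are empty the play ends and Duplicator wins only if the winning condition holds for the current tuples, instead of winning outright. The statement above fails without it. -}

module Defs where

open import Data.Nat using (ℕ; zero; suc; _+_; _*_)
open import Data.Fin using (Fin)
open import Data.Bool using (Bool; true; false)
open import Data.Vec using (Vec; _∷_; lookup)
open import Data.Product using (_×_; Σ; ∃)
open import Data.Sum using (_⊎_)
open import Data.Empty using (⊥)
open import Relation.Binary.PropositionalEquality using (_≡_)
open import Relation.Nullary using (¬_)
open import Function.Bundles using (_⇔_)

l : ℕ → ℕ
l zero = 0
l (suc i) = 2 * l i + 1

record Graph : Set where
  field
    n      : ℕ
    adj    : Fin n → Fin n → Bool
    sym    : ∀ u v → adj u v ≡ adj v u
    irrefl : ∀ v → adj v v ≡ false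
    nlab   : ℕ
    lab    : Fin nlab → Fin n → Bool

module _ (G : Graph) where
  open Graph G

  V : Set
  V = Fin n

  E : V → V → Set
  E u v = adj u v ≡ true

  InD : V → V → V → Set
  InD u v w = (E u w × ¬ E v w) ⊎ (¬ E u w × E v w)

  Win : ∀ {k} → Vec V k → Vec V k → Set
  Win {k} a b =
    (∀ (i j : Fin k) → (lookup a i ≡ lookup a j) ⇔ (lookup b i ≡ lookup b j)) ×
    (∀ (i j : Fin k) → E (lookup a i) (lookup a j) ⇔ E (lookup b i) (lookup b j)) ×
    (∀ (i : Fin k) (p : Fin nlab) → lab p (lookup a i) ≡ lab p (lookup b i))

  -- ā ≅_m b̄ : Duplicator wins the standard m-round EF game on two copies of G
  -- (the newly chosen pair is added to the tuples; the order of the tuple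
  -- entries is irrelevant to the winning condition).
  EF : ℕ → ∀ {k} → Vec V k → Vec V k → Set
  EF zero    a b = Win a b
  EF (suc m) a b =
    (∀ (v : V) → ∃ λ (w : V) → EF m (v ∷ a) (w ∷ b)) ×
    (∀ (w : V) → ∃ λ (v : V) → EF m (v ∷ a) (w ∷ b))

  AllDEmpty : ∀ {k} → Vec V k → Vec V k → Set
  AllDEmpty {k} a b = ∀ (i : Fin k) (w : V) → ¬ InD (lookup a i) (lookup b i) w

  -- ā ≅^D_m b̄ : Duplicator wins the m-round differential game.
  -- If Spoiler has no legal move (all D(a_i,b_i) empty) the play ends and
  -- the winning condition is evaluated.
  DG : ℕ → ∀ {k} → Vec V k → Vec V k → Set
  DG zero    a b = Win a b
  DG (suc m) {k} a b =
    (AllDEmpty a b → Win a b) ×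
    (∀ (i : Fin k) (w : V) → InD (lookup a i) (lookup b i) w →
       (∃ λ (w' : V) → InD (lookup a i) (lookup b i) w' × DG m (w ∷ a) (w' ∷ b)) ×
       (∃ λ (w' : V) → InD (lookup a i) (lookup b i) w' × DG m (w' ∷ a) (w ∷ b)))

module Submission where

-- As l(m+1) = L + (L+1) with L = l(m), the step is the
-- one-round statement one-round-response: from a won position of
-- DG_{L+(L+1)}(ā, b̄) every new vertex v has an answer z with DG_L(vā, zb̄)
-- won.  The games are finite and decidable, so it suffices to refute the
-- assumption N that no z works.  Under N, v is never a pebble and never lies
-- in a difference set of a position with L+1 rounds to go.  The v-chain
-- v, a_j (b_j = v), a_j' (b_j' = a_j), ... leaves b̄ by pigeonhole at some z,
-- and Duplicator wins DG_L(vā, zb̄) by copying her strategy for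
-- DG_{L+(L+1)}(ā, b̄) (simulate), contradicting N.

open import Defs
open import Data.Nat using (ℕ; zero; suc; _+_; _*_; _≤_; _<_; s≤s)
open import Data.Nat.Properties using (n≤1+n; m≤n+m; m≤m+n; n<1+n; +-suc; +-comm; +-identityʳ)
open import Data.Fin using (Fin; zero; suc; toℕ; lift)
open import Data.Fin.Properties using (any?; all?; pigeonhole) renaming (_≟_ to _≟F_)
open import Data.Bool using (Bool; true; false)
open import Data.Bool.Properties using () renaming (_≟_ to _≟B_)
open import Data.Vec using (Vec; _∷_; lookup)
open import Data.Product using (_×_; Σ; ∃; _,_; proj₁; proj₂; map₂; uncurry)
open import Data.Sum using (_⊎_; inj₁; inj₂)
open import Data.Empty using (⊥; ⊥-elim)
open import Relation.Binary.PropositionalEquality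
  using (_≡_; _≢_; refl; sym; trans; cong; subst; subst₂; module ≡-Reasoning)
open import Relation.Nullary using (¬_; Dec; yes; no; ¬?)
open import Relation.Nullary.Decidable using (_×-dec_; _→-dec_; map′)
open import Function.Bundles using (_⇔_; mk⇔; Equivalence)

open Equivalence using (to; from)

l-suc : ∀ m → l (suc m) ≡ l m + suc (l m)
l-suc m = begin
  2 * L + 1         ≡⟨ +-comm (2 * L) 1 ⟩
  suc (L + (L + 0)) ≡⟨ cong (λ t → suc (L + t)) (+-identityʳ L) ⟩
  suc (L + L)       ≡⟨ sym (+-suc L L) ⟩
  L + suc L         ∎
  where
  open ≡-Reasoning
  L = l m

true-⇔⇒≡ : ∀ {x y : Bool} → (x ≡ true) ⇔ (y ≡ true) → x ≡ y
true-⇔⇒≡ {true}  {true}  _ = refl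
true-⇔⇒≡ {true}  {false} e = sym (to e refl)
true-⇔⇒≡ {false} {true}  e = from e refl
true-⇔⇒≡ {false} {false} _ = refl

≡⇒true-⇔ : ∀ {x y : Bool} → x ≡ y → (x ≡ true) ⇔ (y ≡ true)
≡⇒true-⇔ x≡y = mk⇔ (trans (sym x≡y)) (trans x≡y)

_⇔?_ : ∀ {A B : Set} → Dec A → Dec B → Dec (A ⇔ B)
a? ⇔? b? = map′ (uncurry mk⇔) (λ e → to e , from e) ((a? →-dec b?) ×-dec (b? →-dec a?))

module Games (G : Graph) where
  open Graph G using (adj; irrefl; lab) renaming (sym to adj-sym)

  Tuple : ℕ → Set
  Tuple = Vec (V G)

  InD⇒≢ : ∀ {u v w} → InD G u v w → adj u w ≢ adj v w
  InD⇒≢ (inj₁ (uw , ¬vw)) e = ¬vw (trans (sym e) uw)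
  InD⇒≢ (inj₂ (¬uw , vw)) e = ¬uw (trans e vw)

  ≢⇒InD : ∀ {u v w} → adj u w ≢ adj v w → InD G u v w
  ≢⇒InD {u} {v} {w} ne with adj u w | adj v w
  ... | true  | true  = ⊥-elim (ne refl)
  ... | true  | false = inj₁ (refl , λ ())
  ... | false | true  = inj₂ ((λ ()) , refl)
  ... | false | false = ⊥-elim (ne refl)

  InD? : ∀ u v w → Dec (InD G u v w)
  InD? u v w = map′ ≢⇒InD InD⇒≢ (¬? (adj u w ≟B adj v w))

  ¬InD⇒≡ : ∀ {u v w} → ¬ InD G u v w → adj u w ≡ adj v w
  ¬InD⇒≡ {u} {v} {w} w∉D with adj u w ≟B adj v w
  ... | yes e = e
  ... | no ne = ⊥-elim (w∉D (≢⇒InD ne))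

  InD-sym : ∀ {u v w} → InD G u v w → InD G v u w
  InD-sym (inj₁ (p , q)) = inj₂ (q , p)
  InD-sym (inj₂ (p , q)) = inj₁ (q , p)

  no-loops : ∀ x → ¬ E G x x
  no-loops x x~x with trans (sym x~x) (irrefl x)
  ... | ()

  module _ {k} {c d : Tuple k} where
    Win-≡ : Win G c d → ∀ i j → (lookup c i ≡ lookup c j) ⇔ (lookup d i ≡ lookup d j)
    Win-≡ = proj₁

    Win-E : Win G c d → ∀ i j → E G (lookup c i) (lookup c j) ⇔ E G (lookup d i) (lookup d j)
    Win-E w = proj₁ (proj₂ w)

    Win-lab : Win G c d → ∀ i q → lab q (lookup c i) ≡ lab q (lookup d i)
    Win-lab w = proj₂ (proj₂ w)

  Win? : ∀ {k} (c d : Tuple k) → Dec (Win G c d)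
  Win? c d =
    all? (λ i → all? (λ j → (lookup c i ≟F lookup c j) ⇔? (lookup d i ≟F lookup d j))) ×-dec
    (all? (λ i → all? (λ j → (adj (lookup c i) (lookup c j) ≟B true)
                          ⇔? (adj (lookup d i) (lookup d j) ≟B true))) ×-dec
     all? (λ i → all? (λ q → lab q (lookup c i) ≟B lab q (lookup d i))))

  DG? : ∀ m {k} (c d : Tuple k) → Dec (DG G m c d)
  DG? zero    c d = Win? c d
  DG? (suc m) c d =
    (all? (λ i → all? (λ w → ¬? (InD? (lookup c i) (lookup d i) w))) →-dec Win? c d) ×-dec
    all? (λ i → all? (λ w → InD? (lookup c i) (lookup d i) w →-dec
      (any? (λ w' → InD? (lookup c i) (lookup d i) w' ×-dec DG? m (w ∷ c) (w' ∷ d)) ×-dec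
       any? (λ w' → InD? (lookup c i) (lookup d i) w' ×-dec DG? m (w' ∷ c) (w ∷ d)))))

  Win-tail : ∀ {k} {x y} {c d : Tuple k} → Win G (x ∷ c) (y ∷ d) → Win G c d
  Win-tail (eq , e , lb) = (λ i j → eq (suc i) (suc j)) , (λ i j → e (suc i) (suc j)) , (λ i q → lb (suc i) q)

  -- A won position of DG satisfies the winning condition: if Spoiler can
  -- move at all, the condition holds after his move, hence before it.
  DG⇒Win : ∀ m {k} {c d : Tuple k} → DG G m c d → Win G c d
  DG⇒Win zero    dg = dg
  DG⇒Win (suc m) {c = c} {d} (stuck , moves)
    with any? (λ i → any? (λ w → InD? (lookup c i) (lookup d i) w))
  ... | yes (i , w , w∈D) = Win-tail (DG⇒Win m (proj₂ (proj₂ (proj₁ (moves i w w∈D)))))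
  ... | no  none          = stuck (λ i w w∈D → none (i , w , w∈D))

  DG-antitone : ∀ {m m' k} {c d : Tuple k} → m ≤ m' → DG G m' c d → DG G m c d
  DG-antitone {zero}  {m'}     _           dg              = DG⇒Win m' dg
  DG-antitone {suc m} {suc m'} (s≤s m≤m') (stuck , moves) =
    stuck , λ i w w∈D → let (forth , back) = moves i w w∈D in
      map₂ (map₂ (DG-antitone m≤m')) forth , map₂ (map₂ (DG-antitone m≤m')) back

  Win-swap : ∀ {k} {c d : Tuple k} → Win G c d → Win G d c
  Win-swap (eq , e , lb) =
    (λ i j → mk⇔ (from (eq i j)) (to (eq i j))) ,
    (λ i j → mk⇔ (from (e i j)) (to (e i j))) ,
    (λ i q → sym (lb i q))

  DG-swap : ∀ m {k} {c d : Tuple k} → DG G m c d → DG G m d c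
  DG-swap zero    {c = c} {d} dg              = Win-swap {c = c} {d} dg
  DG-swap (suc m) {c = c} {d} (stuck , moves) =
    (λ none → Win-swap {c = c} {d} (stuck (λ i w w∈D → none i w (InD-sym w∈D)))) ,
    λ i w w∈D → let (forth , back) = moves i w (InD-sym {lookup d i} {lookup c i} w∈D) in
      map₂ (λ (p , dg) → InD-sym p , DG-swap m dg) back ,
      map₂ (λ (p , dg) → InD-sym p , DG-swap m dg) forth

  Reindex : ∀ {k k'} → (Fin k' → Fin k) → Tuple k → Tuple k' → Set
  Reindex f c c' = ∀ i → lookup c' i ≡ lookup c (f i)

  reindex-cons : ∀ {k k'} {f : Fin k' → Fin k} {c c'} (x : V G) →
    Reindex f c c' → Reindex (lift 1 f) (x ∷ c) (x ∷ c')
  reindex-cons x r zero    = refl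
  reindex-cons x r (suc i) = r i

  -- Both games only see the tuples through their entries, so winning is
  -- preserved by passing to reindexed tuples (forgetting or repeating pebbles).
  Win-reindex : ∀ {k k'} (f : Fin k' → Fin k) {c d : Tuple k} {c' d' : Tuple k'} →
    Reindex f c c' → Reindex f d d' → Win G c d → Win G c' d'
  Win-reindex f {c' = c'} {d'} rc rd (eq , e , lb) = eq' , e' , lb'
    where
    eq' : ∀ i j → (lookup c' i ≡ lookup c' j) ⇔ (lookup d' i ≡ lookup d' j)
    eq' i j rewrite rc i | rc j | rd i | rd j = eq (f i) (f j)
    e' : ∀ i j → E G (lookup c' i) (lookup c' j) ⇔ E G (lookup d' i) (lookup d' j)
    e' i j rewrite rc i | rc j | rd i | rd j = e (f i) (f j)
    lb' : ∀ i q → lab q (lookup c' i) ≡ lab q (lookup d' i)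
    lb' i q rewrite rc i | rd i = lb (f i) q

  DG-reindex : ∀ m {k k'} (f : Fin k' → Fin k) {c d : Tuple k} {c' d' : Tuple k'} →
    Reindex f c c' → Reindex f d d' → DG G m c d → DG G m c' d'
  DG-reindex zero    f {c} {d} {c'} {d'} rc rd dg = Win-reindex f {c} {d} {c'} {d'} rc rd dg
  DG-reindex (suc m) f {c} {d} {c'} {d'} rc rd dg@(_ , moves) =
    (λ _ → Win-reindex f {c} {d} {c'} {d'} rc rd (DG⇒Win (suc m) dg)) , moves'
    where
    into : ∀ {i w} → InD G (lookup c' i) (lookup d' i) w → InD G (lookup c (f i)) (lookup d (f i)) w
    into {i} {w} = subst₂ (λ u x → InD G u x w) (rc i) (rd i)
    back : ∀ {i w} → InD G (lookup c (f i)) (lookup d (f i)) w → InD G (lookup c' i) (lookup d' i) w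
    back {i} {w} = subst₂ (λ u x → InD G u x w) (sym (rc i)) (sym (rd i))
    moves' : ∀ i w → InD G (lookup c' i) (lookup d' i) w →
      (∃ λ w' → InD G (lookup c' i) (lookup d' i) w' × DG G m (w ∷ c') (w' ∷ d')) ×
      (∃ λ w' → InD G (lookup c' i) (lookup d' i) w' × DG G m (w' ∷ c') (w ∷ d'))
    moves' i w w∈D with moves (f i) w (into w∈D)
    ... | (w₁ , p₁ , dg₁) , (w₂ , p₂ , dg₂) =
      (w₁ , back p₁ ,
        DG-reindex m (lift 1 f) (reindex-cons w rc) (reindex-cons w₁ rd) dg₁) ,
      (w₂ , back p₂ ,
        DG-reindex m (lift 1 f) (reindex-cons w₂ rc) (reindex-cons w rd) dg₂)

  -- In a won position with a round to go, if c_j ∈ D(c_p, d_p) then also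
  -- d_j ∈ D(c_p, d_p): Spoiler may play c_j at p, and the equality pattern
  -- forces Duplicator to answer d_j.
  DG-forces-partner : ∀ m {k} {c d : Tuple k} → DG G (suc m) c d → ∀ p j →
    InD G (lookup c p) (lookup d p) (lookup c j) → InD G (lookup c p) (lookup d p) (lookup d j)
  DG-forces-partner m {c = c} {d} (_ , moves) p j cⱼ∈D
    with proj₁ (moves p (lookup c j) cⱼ∈D)
  ... | (y , y∈D , dg) =
    subst (InD G (lookup c p) (lookup d p)) y≡dⱼ y∈D
    where
    y≡dⱼ : y ≡ lookup d j
    y≡dⱼ = to (Win-≡ {c = lookup c j ∷ c} {y ∷ d} (DG⇒Win m dg) zero (suc j)) refl

  data Chain (v : V G) {k} (c d : Tuple k) : V G → Set where
    start : Chain v c d v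
    step  : ∀ {x} (j : Fin k) → Chain v c d x → lookup d j ≡ x → Chain v c d (lookup c j)

  chain-cons : ∀ {v k} {c d : Tuple k} {x w w'} → Chain v c d x → Chain v (w ∷ c) (w' ∷ d) x
  chain-cons start          = start
  chain-cons (step j ch eq) = step (suc j) (chain-cons ch) eq

  chain-labels : ∀ {v k} {c d : Tuple k} → Win G c d → ∀ {x} → Chain v c d x →
    ∀ q → lab q x ≡ lab q v
  chain-labels             W start            q = refl
  chain-labels {c = c} {d} W (step j ch dⱼ≡x) q =
    trans (Win-lab {c = c} {d} W j q) (trans (cong (lab q) dⱼ≡x) (chain-labels W ch q))

  -- A vertex distinguishing v from a chain vertex lies in some difference set
  -- D(c_p, d_p): along each step the adjacency towards it is unchanged otherwise.
  chain-differences : ∀ {v k} {c d : Tuple k} {x w} → Chain v c d x → InD G v x w →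
    ∃ λ p → InD G (lookup c p) (lookup d p) w
  chain-differences start w∈D = ⊥-elim (InD⇒≢ w∈D refl)
  chain-differences {v} {c = c} {d} {w = w} (step {x} j ch dⱼ≡x) w∈D
    with InD? (lookup c j) (lookup d j) w
  ... | yes w∈Dⱼ = j , w∈Dⱼ
  ... | no  w∉Dⱼ = chain-differences ch (≢⇒InD v≁x)
    where
    v≁x : adj v w ≢ adj x w
    v≁x e = InD⇒≢ w∈D (trans e (trans (cong (λ t → adj t w) (sym dⱼ≡x)) (sym (¬InD⇒≡ w∉Dⱼ))))

  chain-quiet : ∀ m {v k} {c d : Tuple k} → DG G (suc m) c d → ∀ p →
    ¬ InD G (lookup c p) (lookup d p) v → ∀ {x} → Chain v c d x →
    ¬ InD G (lookup c p) (lookup d p) x × adj (lookup c p) x ≡ adj (lookup c p) v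
  chain-quiet m dg p v∉D start = v∉D , refl
  chain-quiet m {v} {c = c} {d} dg p v∉D (step {x} j ch dⱼ≡x)
    with chain-quiet m dg p v∉D ch
  ... | (x∉D , cₚx≡cₚv) = cⱼ∉D , cₚcⱼ≡cₚv
    where
    cⱼ∉D : ¬ InD G (lookup c p) (lookup d p) (lookup c j)
    cⱼ∉D cⱼ∈D = x∉D (subst (InD G (lookup c p) (lookup d p)) dⱼ≡x (DG-forces-partner m dg p j cⱼ∈D))
    open ≡-Reasoning
    cₚcⱼ≡cₚv : adj (lookup c p) (lookup c j) ≡ adj (lookup c p) v
    cₚcⱼ≡cₚv = begin
      adj (lookup c p) (lookup c j) ≡⟨ true-⇔⇒≡ (Win-E {c = c} {d} (DG⇒Win (suc m) dg) p j) ⟩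
      adj (lookup d p) (lookup d j) ≡⟨ cong (adj (lookup d p)) dⱼ≡x ⟩
      adj (lookup d p) x            ≡⟨ sym (¬InD⇒≡ x∉D) ⟩
      adj (lookup c p) x            ≡⟨ cₚx≡cₚv ⟩
      adj (lookup c p) v            ∎

  chain-in-D : ∀ m {v k} {c d : Tuple k} → DG G (suc m) c d → ∀ p {x} → Chain v c d x →
    InD G (lookup c p) (lookup d p) x → InD G (lookup c p) (lookup d p) v
  chain-in-D m {v} {c = c} {d} dg p ch x∈D with InD? (lookup c p) (lookup d p) v
  ... | yes v∈D = v∈D
  ... | no  v∉D = ⊥-elim (proj₁ (chain-quiet m dg p v∉D ch) x∈D)

  -- If v does not occur in c and equal entries of c have equal partners in d,
  -- the v-chain cannot stay inside d: it would visit more distinct vertices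
  -- than G has.
  chain-escapes : ∀ {v k} {c d : Tuple k} → (∀ i → lookup c i ≢ v) →
    (∀ i j → lookup c i ≡ lookup c j → lookup d i ≡ lookup d j) →
    ¬ (∀ x → Chain v c d x → ∃ λ i → lookup d i ≡ x)
  chain-escapes {v} {c = c} {d} v∉c injective inside =
    let (s , s' , s<s' , same) = pigeonhole (n<1+n _) (λ s → vertex (toℕ s))
    in distinct (toℕ s) (toℕ s') s<s' same
    where
    walk : ℕ → Σ (V G) (Chain v c d)
    walk zero    = v , start
    walk (suc s) = let (x , ch) = walk s ; (j , dⱼ≡x) = inside x ch in lookup c j , step j ch dⱼ≡x
    vertex : ℕ → V G
    vertex s = proj₁ (walk s)
    found : ∀ s → ∃ λ j → lookup d j ≡ vertex s
    found s = inside (vertex s) (proj₂ (walk s))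
    distinct : ∀ s s' → s < s' → vertex s ≢ vertex s'
    distinct zero    (suc s') _          eq = v∉c (proj₁ (found s')) (sym eq)
    distinct (suc s) (suc s') (s≤s s<s') eq = distinct s s' s<s' (begin
      vertex s                      ≡⟨ sym (proj₂ (found s)) ⟩
      lookup d (proj₁ (found s))    ≡⟨ injective (proj₁ (found s)) (proj₁ (found s')) eq ⟩
      lookup d (proj₁ (found s'))   ≡⟨ proj₂ (found s') ⟩
      vertex s'                     ∎)
      where open ≡-Reasoning

  module Refutation (L : ℕ) {k} (a b : Tuple k) (v : V G)
                    (N : ∀ z → ¬ DG G L (v ∷ a) (z ∷ b)) where

    Extends : ∀ {k'} → Tuple k' → Tuple k' → Set
    Extends {k'} c d = Σ (Fin k → Fin k') λ ι → Reindex ι c a × Reindex ι d b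

    initial : Extends a b
    initial = (λ i → i) , (λ _ → refl) , (λ _ → refl)

    extends-cons : ∀ {k'} {c d : Tuple k'} {x y} → Extends c d → Extends (x ∷ c) (y ∷ d)
    extends-cons (ι , rc , rd) = (λ i → suc (ι i)) , rc , rd

    -- Under N, v is never a pebble of a position won for L more rounds:
    -- forgetting the other new pebbles would give a won DG_L(vā, d_i b̄).
    v-unplayed : ∀ {k'} {c d : Tuple k'} → Extends c d → ∀ i → lookup c i ≡ v → ¬ DG G L c d
    v-unplayed {k'} {c} {d} (ι , rc , rd) i cᵢ≡v dg = N (lookup d i) (DG-reindex L f rc' rd' dg)
      where
      f : Fin (suc k) → Fin k'
      f zero    = i
      f (suc j) = ι j
      rc' : Reindex f c (v ∷ a)
      rc' zero    = sym cᵢ≡v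
      rc' (suc j) = rc j
      rd' : Reindex f d (lookup d i ∷ b)
      rd' zero    = refl
      rd' (suc j) = rd j

    -- Under N, v lies in no difference set of a position won for L+1 more
    -- rounds: Spoiler would play v there.
    v-outside-D : ∀ {k'} {c d : Tuple k'} → Extends c d → ∀ p →
      InD G (lookup c p) (lookup d p) v → ¬ DG G (suc L) c d
    v-outside-D ext p v∈D (_ , moves) with proj₁ (moves p v v∈D)
    ... | (_ , _ , dg) = v-unplayed (extends-cons ext) zero refl dg

    Covered : ∀ {k'} → Tuple k' → Tuple k' → V G → Set
    Covered c d z =
      ∀ i → lookup d i ≡ z → (lookup c i ≡ v) ⊎ (∃ λ p → InD G (lookup c p) (lookup d p) z)

    covered-cons : ∀ {k'} {c d : Tuple k'} {z x y} → Covered c d z →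
      ∀ p → InD G (lookup c p) (lookup d p) y → Covered (x ∷ c) (y ∷ d) z
    covered-cons {c = c} {d} cov p y∈D zero y≡z =
      inj₂ (suc p , subst (InD G (lookup c p) (lookup d p)) y≡z y∈D)
    covered-cons cov p y∈D (suc i) dᵢ≡z with cov i dᵢ≡z
    ... | inj₁ cᵢ≡v      = inj₁ cᵢ≡v
    ... | inj₂ (q , z∈D) = inj₂ (suc q , z∈D)

    z-pattern : ∀ {k'} {c d : Tuple k'} {z} → Extends c d → Chain v c d z → Covered c d z →
      DG G (suc L) c d → ∀ j → z ≡ lookup d j → v ≡ lookup c j
    z-pattern ext ch cov dg j z≡dⱼ with cov j (sym z≡dⱼ)
    ... | inj₁ cⱼ≡v      = sym cⱼ≡v
    ... | inj₂ (p , z∈D) = ⊥-elim (v-outside-D ext p (chain-in-D L dg p ch z∈D) dg)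

    chain-end-quiet : ∀ {k'} {c d : Tuple k'} {z} → Extends c d → Chain v c d z →
      DG G (suc L) c d → ∀ j →
      ¬ InD G (lookup c j) (lookup d j) z × adj (lookup c j) z ≡ adj (lookup c j) v
    chain-end-quiet {c = c} {d} ext ch dg j with InD? (lookup c j) (lookup d j) v
    ... | yes v∈D = ⊥-elim (v-outside-D ext j v∈D dg)
    ... | no  v∉D = chain-quiet L dg j v∉D ch

    v-adjacency : ∀ {k'} {c d : Tuple k'} {z} → Extends c d → Chain v c d z →
      DG G (suc L) c d → ∀ j → adj v (lookup c j) ≡ adj z (lookup d j)
    v-adjacency {c = c} {d} {z} ext ch dg j = begin
      adj v (lookup c j) ≡⟨ adj-sym v (lookup c j) ⟩
      adj (lookup c j) v ≡⟨ sym (proj₂ quiet) ⟩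
      adj (lookup c j) z ≡⟨ ¬InD⇒≡ (proj₁ quiet) ⟩
      adj (lookup d j) z ≡⟨ adj-sym (lookup d j) z ⟩
      adj z (lookup d j) ∎
      where
      open ≡-Reasoning
      quiet : ¬ InD G (lookup c j) (lookup d j) z × adj (lookup c j) z ≡ adj (lookup c j) v
      quiet = chain-end-quiet ext ch dg j

    win-extend : ∀ {k'} {c d : Tuple k'} {z} → Extends c d → Chain v c d z → Covered c d z →
      DG G (suc L) c d → Win G (v ∷ c) (z ∷ d)
    win-extend {c = c} {d} {z} ext ch cov dg = equalities , edges , labels
      where
      W : Win G c d
      W = DG⇒Win (suc L) dg
      v∉c : ∀ j → v ≢ lookup c j
      v∉c j v≡cⱼ = v-unplayed ext j (sym v≡cⱼ) (DG-antitone (n≤1+n L) dg)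
      equalities : ∀ i j → (lookup (v ∷ c) i ≡ lookup (v ∷ c) j) ⇔ (lookup (z ∷ d) i ≡ lookup (z ∷ d) j)
      equalities zero    zero    = mk⇔ (λ _ → refl) (λ _ → refl)
      equalities zero    (suc j) = mk⇔ (λ v≡cⱼ → ⊥-elim (v∉c j v≡cⱼ)) (z-pattern ext ch cov dg j)
      equalities (suc i) zero    =
        mk⇔ (λ cᵢ≡v → ⊥-elim (v∉c i (sym cᵢ≡v))) (λ dᵢ≡z → sym (z-pattern ext ch cov dg i (sym dᵢ≡z)))
      equalities (suc i) (suc j) = Win-≡ {c = c} {d} W i j
      edges : ∀ i j → E G (lookup (v ∷ c) i) (lookup (v ∷ c) j) ⇔ E G (lookup (z ∷ d) i) (lookup (z ∷ d) j)
      edges zero    zero    = mk⇔ (λ v~v → ⊥-elim (no-loops v v~v)) (λ z~z → ⊥-elim (no-loops z z~z))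
      edges zero    (suc j) = ≡⇒true-⇔ (v-adjacency ext ch dg j)
      edges (suc i) zero    = ≡⇒true-⇔ (trans (adj-sym (lookup c i) v)
                                 (trans (v-adjacency ext ch dg i) (adj-sym z (lookup d i))))
      edges (suc i) (suc j) = Win-E {c = c} {d} W i j
      labels : ∀ i q → lab q (lookup (v ∷ c) i) ≡ lab q (lookup (z ∷ d) i)
      labels zero    q = sym (chain-labels W ch q)
      labels (suc i) q = Win-lab {c = c} {d} W i q

    swap01 : ∀ {k'} → Fin (2 + k') → Fin (2 + k')
    swap01 zero          = suc zero
    swap01 (suc zero)    = zero
    swap01 (suc (suc j)) = suc (suc j)

    reindex-swap01 : ∀ {k'} (x y : V G) (c : Tuple k') → Reindex swap01 (y ∷ x ∷ c) (x ∷ y ∷ c)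
    reindex-swap01 x y c zero          = refl
    reindex-swap01 x y c (suc zero)    = refl
    reindex-swap01 x y c (suc (suc j)) = refl

    -- Under N, for z on the v-chain and covered, Duplicator wins DG_K(vc, zd)
    -- by copying her strategy for DG_{K+(L+1)}(c, d).  Spoiler can never move
    -- at the new pair: a vertex w of D(v, z) lies in an old difference set,
    -- and answering w there would put v into a difference set or break the
    -- adjacency of w towards the chain.
    simulate : ∀ K {k'} (c d : Tuple k') {z} → Extends c d → Chain v c d z → Covered c d z →
      DG G (K + suc L) c d → DG G K (v ∷ c) (z ∷ d)
    simulate zero    c d ext ch cov dg = win-extend ext ch cov dg
    simulate (suc K) c d {z} ext ch cov dg@(_ , moves) =
      (λ _ → win-extend ext ch cov (DG-antitone (m≤n+m (suc L) (suc K)) dg)) , moves'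
      where
      D-v-z-empty : ∀ {w} → ¬ InD G v z w
      D-v-z-empty {w} w∈D with chain-differences ch w∈D
      ... | (p , w∈Dₚ) with proj₁ (moves p w w∈Dₚ)
      ... | (w' , _ , dg') = InD⇒≢ w∈D (begin
        adj v w ≡⟨ adj-sym v w ⟩
        adj w v ≡⟨ sym (proj₂ (chain-end-quiet (extends-cons ext) (chain-cons ch) dg'' zero)) ⟩
        adj w z ≡⟨ adj-sym w z ⟩
        adj z w ∎)
        where
        open ≡-Reasoning
        dg'' : DG G (suc L) (w ∷ c) (w' ∷ d)
        dg'' = DG-antitone (m≤n+m (suc L) K) dg'
      moves' : ∀ i w → InD G (lookup (v ∷ c) i) (lookup (z ∷ d) i) w →
        (∃ λ w' → InD G (lookup (v ∷ c) i) (lookup (z ∷ d) i) w' × DG G K (w ∷ v ∷ c) (w' ∷ z ∷ d)) ×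
        (∃ λ w' → InD G (lookup (v ∷ c) i) (lookup (z ∷ d) i) w' × DG G K (w' ∷ v ∷ c) (w ∷ z ∷ d))
      moves' zero    w w∈D = ⊥-elim (D-v-z-empty w∈D)
      moves' (suc i) w w∈D with moves i w w∈D
      ... | (w₁ , w₁∈D , dg₁) , (w₂ , w₂∈D , dg₂) =
        (w₁ , w₁∈D , DG-reindex K swap01 (reindex-swap01 w v c) (reindex-swap01 w₁ z d)
          (simulate K (w ∷ c) (w₁ ∷ d) (extends-cons ext) (chain-cons ch) (covered-cons cov i w₁∈D) dg₁)) ,
        (w₂ , w₂∈D , DG-reindex K swap01 (reindex-swap01 w₂ v c) (reindex-swap01 w z d)
          (simulate K (w₂ ∷ c) (w ∷ d) (extends-cons ext) (chain-cons ch) (covered-cons cov i w∈D) dg₂))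

    -- N is impossible when DG_{L+(L+1)}(ā, b̄) is won: v is not among ā, so
    -- the v-chain leaves b̄ at some z, and simulate wins DG_L(vā, zb̄).
    refute : ¬ DG G (L + suc L) a b
    refute dg with any? (λ i → lookup a i ≟F v)
    ... | yes (i , aᵢ≡v) = v-unplayed initial i aᵢ≡v (DG-antitone (m≤m+n L (suc L)) dg)
    ... | no  v∉a        =
      chain-escapes (λ i aᵢ≡v → v∉a (i , aᵢ≡v))
                    (λ i j → to (Win-≡ {c = a} {b} (DG⇒Win _ dg) i j)) inside
      where
      inside : ∀ x → Chain v a b x → ∃ λ i → lookup b i ≡ x
      inside x ch with any? (λ i → lookup b i ≟F x)
      ... | yes found = found
      ... | no  x∉b   =
        ⊥-elim (N x (simulate L a b initial ch (λ i bᵢ≡x → ⊥-elim (x∉b (i , bᵢ≡x))) dg))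

  one-round-response : ∀ L {k} (a b : Tuple k) → DG G (L + suc L) a b →
    ∀ v → ∃ λ z → DG G L (v ∷ a) (z ∷ b)
  one-round-response L a b dg v with any? (λ z → DG? L (v ∷ a) (z ∷ b))
  ... | yes answer = answer
  ... | no  none   = ⊥-elim (Refutation.refute L a b v (λ z dg' → none (z , dg')) dg)

  DG⇒EF : ∀ m {k} (a b : Tuple k) → DG G (l m) a b → EF G m a b
  DG⇒EF zero    a b dg = dg
  DG⇒EF (suc m) a b dg = forth , back
    where
    dg' : DG G (l m + suc (l m)) a b
    dg' = subst (λ t → DG G t a b) (l-suc m) dg
    forth : ∀ v → ∃ λ w → EF G m (v ∷ a) (w ∷ b)
    forth v with one-round-response (l m) a b dg' v
    ... | (w , dgᵥ) = w , DG⇒EF m (v ∷ a) (w ∷ b) dgᵥ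
    back : ∀ w → ∃ λ v → EF G m (v ∷ a) (w ∷ b)
    back w with one-round-response (l m) b a (DG-swap (l m + suc (l m)) dg') w
    ... | (v , dgʷ) = v , DG⇒EF m (v ∷ a) (w ∷ b) (DG-swap (l m) dgʷ)

lemma6p3 : (m : ℕ) (G : Graph) {k : ℕ} (a b : Vec (V G) k) →
    ¬ EF G m a b → ¬ DG G (l m) a b
lemma6p3 m G a b ¬ef dg = ¬ef (Games.DG⇒EF G m a b dg)
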